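{- Let $i \geq 4$ be an integer and let $G$ be an $(i,2)$ phylogeny graph. Then $\omega(G) \leq \frac{3i}{2}+1$. Moreover, the inequality is tight: for every integer $i\geq 4$ there exists an $(i,2)$ phylogeny graph containing a clique of size $\lfloor 3i/2\rfloor + 1$.
   Context: An $(i,j)$ digraph is an acyclic digraph in which every vertex has indegree at most $i$ and outdegree at most $j$. The phylogeny graph $P(D)$ has vertex set $V(D)$ and an edge between distinct $u,v$ iff $(u,v)\in A(D)$ or $(v,u)\in A(D)$ or $u,v$ have a common out-neighbor in $D$. A graph is an $(i,j)$ phylogeny graph if it is isomorphic to $P(D)$ for some $(i,j)$ digraph $D$. $\omega(G)$ denotes the maximum size of a clique in $G$. -}

module Defs where

open import Data.Nat using (ℕ; zero; suc; _+_; _*_; _≤_; _/_)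
open import Data.Bool using (Bool; true; false; T)
open import Data.Fin using (Fin)
open import Data.List using (List; length; filter; allFin)
open import Data.List.Membership.Propositional using (_∈_)
open import Data.List.Relation.Unary.Unique.Propositional using (Unique)
open import Data.Product using (Σ; ∃; _×_; _,_)
open import Data.Sum using (_⊎_)
open import Data.Empty using (⊥)
open import Relation.Nullary using (¬_)
open import Relation.Binary.PropositionalEquality using (_≡_; _≢_)
open import Relation.Binary.Construct.Closure.Transitive using (TransClosure)
open import Function.Bundles using (_⤖_; Bijection)
open import Function.Bundles using (_⇔_)
import Relation.Nullary.Decidable as Dec
open import Data.Bool.Properties using (T?)

-- A (loopless-by-acyclicity) digraph on vertex set Fin n; arcs given by a Boolean matrix.
Digraph : ℕ → Set
Digraph n = Fin n → Fin n → Bool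

Arc : ∀ {n} → Digraph n → Fin n → Fin n → Set
Arc D u v = T (D u v)

Acyclic : ∀ {n} → Digraph n → Set
Acyclic D = ∀ v → ¬ TransClosure (Arc D) v v

indeg : ∀ {n} → Digraph n → Fin n → ℕ
indeg {n} D v = length (filter (λ u → T? (D u v)) (allFin n))

outdeg : ∀ {n} → Digraph n → Fin n → ℕ
outdeg {n} D u = length (filter (λ v → T? (D u v)) (allFin n))

IsIJDigraph : ℕ → ℕ → ∀ {n} → Digraph n → Set
IsIJDigraph i j D = Acyclic D × (∀ v → indeg D v ≤ i) × (∀ v → outdeg D v ≤ j)

PAdj : ∀ {n} → Digraph n → Fin n → Fin n → Set
PAdj D u v = u ≢ v × (Arc D u v ⊎ Arc D v u ⊎ ∃ λ w → Arc D u w × Arc D v w)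

record Graph : Set₁ where
  field
    size  : ℕ
    Adj   : Fin size → Fin size → Set
    sym   : ∀ {u v} → Adj u v → Adj v u
    irrefl : ∀ {u} → ¬ Adj u u

IsPhylogenyGraph : ℕ → ℕ → Graph → Set
IsPhylogenyGraph i j G =
  Σ (Digraph (Graph.size G)) λ D → IsIJDigraph i j D ×
    Σ (Fin (Graph.size G) ⤖ Fin (Graph.size G)) λ f →
      ∀ u v → Graph.Adj G u v ⇔ PAdj D (Bijection.to f u) (Bijection.to f v)

IsClique : ∀ {n} → (Fin n → Fin n → Set) → List (Fin n) → Set
IsClique Adj K = Unique K × (∀ {u v} → u ∈ K → v ∈ K → u ≢ v → Adj u v)

{-# OPTIONS --safe #-}
module Submission where

-- Let K be a clique of P(D) and v a vertex of K without out-neighbours in K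
-- (acyclicity).  Every other x ∈ K is adjacent to v, hence sends an arc to a hub: v itself or
-- one of the at most two out-neighbours of v.  Grouping K ∖ {v} into the three hub classes,
-- out-degree ≤ 2 puts each x into one or two classes, with no arc to a non-hub in the second
-- case and at most one (x → f x) in the first.  In-degree ≤ i bounds each class by i, and
-- the classes of the out-hubs by i − 1, since these hubs also receive the arc from v.
-- Vertices in disjoint classes can only be adjacent through arcs to non-hubs, and the sets
-- {x, f x} of the single-class vertices, pairwise intersecting and free of directed
-- triangles, share a point.  A case analysis on the classes containing single-class
-- vertices then gives 2 |K ∖ {v}| ≤ 3i.
--
-- A path A → B → C together with m, m and q vertices whose out-neighbourhoods
-- are {A, B}, {A, C} and {B, C}, for m = ⌊i/2⌋ and q = ⌈i/2⌉ − 1, is an (i,2) digraph in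
-- whose phylogeny graph all vertices except C are pairwise adjacent.

open import Data.Bool using (Bool; true; false; T; if_then_else_)
open import Data.Bool.Properties using (T?)
open import Data.Empty using (⊥; ⊥-elim)
open import Data.Fin using (Fin; zero; suc; _≟_; toℕ)
open import Data.Fin.Patterns using (0F; 1F; 2F)
open import Data.Fin.Properties using (any?; all?; ¬∀⟶∃¬; suc-injective; pigeonhole)
open import Data.List as List using (List; []; _∷_; _++_; length; filter; tabulate; allFin; map; replicate)
open import Data.List.Membership.Propositional using (_∈_)
open import Data.List.Membership.Propositional.Properties using (∈-map⁻; ∈-tabulate⁻; ∈-lookup)
open import Data.List.Properties
  using (length-map; length-++; length-replicate; length-tabulate; filter-++; filter-all; filter-none)
open import Data.List.Relation.Unary.All as All using (All; _∷_; [])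
open import Data.List.Relation.Unary.All.Properties using (replicate⁺; ++⁺)
open import Data.List.Relation.Unary.AllPairs using (_∷_; [])
open import Data.List.Relation.Unary.Any as Any using (here; there)
open import Data.List.Relation.Unary.Unique.Propositional using (Unique)
open import Data.List.Relation.Unary.Unique.Propositional.Properties using (map⁺; tabulate⁺)
open import Data.Nat using (ℕ; zero; suc; _+_; _*_; _≤_; _<_; _/_; z≤n; s≤s)
open import Data.Nat.DivMod using (+-distrib-/-∣ʳ; m<n⇒m/n≡0; m*n/n≡m)
open import Data.Nat.Divisibility using (divides)
open import Data.Nat.Properties
  using ( ≤-refl; ≤-reflexive; ≤-trans; ≤-antisym; <-irrefl; <-trans; <⇒≱; n≤0⇒n≡0; n≤1+n; n<1+n
        ; m≤m+n; m≤n+m; m≤n⇒∃[o]m+o≡n; +-comm; +-suc; +-identityʳ; +-mono-≤; +-monoˡ-≤; +-monoʳ-≤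
        ; +-mono-<-≤; +-mono-≤-<; *-monoʳ-≤; *-distribˡ-+; +-0-commutativeMonoid; module ≤-Reasoning )
open import Data.Nat.Tactic.RingSolver using (solve-∀)
open import Algebra.Properties.CommutativeMonoid.Sum +-0-commutativeMonoid
  using (sum; ∑-distrib-+; sum-replicate-zero)
open import Data.Product using (Σ; ∃; ∃₂; _×_; _,_; proj₁; proj₂)
open import Data.Sum using (_⊎_; inj₁; inj₂)
open import Data.Unit using (⊤; tt)
open import Function using (_∘_)
open import Function.Bundles using (_⤖_; Bijection; _⇔_; Equivalence)
open import Level using (0ℓ)
open import Relation.Binary.Core using (Rel)
open import Relation.Binary.Construct.Closure.Reflexive using (ReflClosure; refl; [_]; reflexive)
import Relation.Binary.Construct.Closure.Transitive as Plus
open Plus using (TransClosure)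
open import Relation.Binary.PropositionalEquality
  using (_≡_; _≢_; refl; sym; trans; cong; cong₂; subst; module ≡-Reasoning)
open import Relation.Nullary using (¬_; Dec; yes; no; does)
open import Relation.Nullary.Decidable using (_×-dec_; _⊎-dec_; _→-dec_; ¬?; decidable-stable)
open import Relation.Unary using (Pred; Decidable; _⊆_; _∪_)

open import Defs

-- Counting elements of decidable subsets of Fin N

𝟙 : {A : Set} → Dec A → ℕ
𝟙 (yes _) = 1
𝟙 (no _)  = 0

-- Opaque, so that unification can recover the decider P? from a goal mentioning count P?.
opaque
  count : {N : ℕ} {P : Pred (Fin N) 0ℓ} → Decidable P → ℕ
  count P? = sum (λ x → 𝟙 (P? x))

AtLeastTwo : Set → Set → Set → Set
AtLeastTwo A B C = A × B ⊎ A × C ⊎ B × C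

𝟙-yes : {A : Set} → A → (a : Dec A) → 1 ≤ 𝟙 a
𝟙-yes p (yes _) = ≤-refl
𝟙-yes p (no ¬p) = ⊥-elim (¬p p)

𝟙-mono : {A B : Set} → (A → B) → (a : Dec A) (b : Dec B) → 𝟙 a ≤ 𝟙 b
𝟙-mono A⇒B (yes p) b = 𝟙-yes (A⇒B p) b
𝟙-mono A⇒B (no _)  b = z≤n

𝟙-⊎ : {A B C : Set} → (A → B ⊎ C) → (a : Dec A) (b : Dec B) (c : Dec C) → 𝟙 a ≤ 𝟙 b + 𝟙 c
𝟙-⊎ h (no _)  b c = z≤n
𝟙-⊎ h (yes p) b c with h p
... | inj₁ q = ≤-trans (𝟙-yes q b) (m≤m+n _ _)
... | inj₂ r = ≤-trans (𝟙-yes r c) (m≤n+m _ _)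

𝟙-disjoint : {A B C : Set} → (B → A) → (C → A) → (B → C → ⊥) →
             (a : Dec A) (b : Dec B) (c : Dec C) → 𝟙 b + 𝟙 c ≤ 𝟙 a
𝟙-disjoint B⇒A C⇒A disj a (yes q) (yes r) = ⊥-elim (disj q r)
𝟙-disjoint B⇒A C⇒A disj a (yes q) (no _)  = ≤-trans (≤-reflexive (+-identityʳ 1)) (𝟙-yes (B⇒A q) a)
𝟙-disjoint B⇒A C⇒A disj a (no _)  (yes r) = 𝟙-yes (C⇒A r) a
𝟙-disjoint B⇒A C⇒A disj a (no _)  (no _)  = z≤n

𝟙-twice : {A B C E : Set} → (A → AtLeastTwo B C E) →
          (a : Dec A) (b : Dec B) (c : Dec C) (e : Dec E) → 𝟙 a + 𝟙 a ≤ 𝟙 b + 𝟙 c + 𝟙 e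
𝟙-twice h (no _)  b c e = z≤n
𝟙-twice h (yes p) b c e with h p
... | inj₁ (pb , pc)        = ≤-trans (+-mono-≤ (𝟙-yes pb b) (𝟙-yes pc c)) (m≤m+n _ _)
... | inj₂ (inj₁ (pb , pe)) = +-mono-≤ (≤-trans (𝟙-yes pb b) (m≤m+n _ _)) (𝟙-yes pe e)
... | inj₂ (inj₂ (pc , pe)) = +-mono-≤ (≤-trans (𝟙-yes pc c) (m≤n+m _ _)) (𝟙-yes pe e)

sum-mono-≤ : ∀ {N} {f g : Fin N → ℕ} → (∀ x → f x ≤ g x) → sum f ≤ sum g
sum-mono-≤ {zero}  f≤g = z≤n
sum-mono-≤ {suc N} f≤g = +-mono-≤ (f≤g zero) (sum-mono-≤ (f≤g ∘ suc))

opaque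
  unfolding count

  count-mono : ∀ {N} {P Q : Pred (Fin N) 0ℓ} {P? : Decidable P} {Q? : Decidable Q} →
               P ⊆ Q → count P? ≤ count Q?
  count-mono {P? = P?} {Q?} P⊆Q = sum-mono-≤ λ x → 𝟙-mono (P⊆Q {x}) (P? x) (Q? x)

  count-cong : ∀ {N} {P Q : Pred (Fin N) 0ℓ} {P? : Decidable P} {Q? : Decidable Q} →
               P ⊆ Q → Q ⊆ P → count P? ≡ count Q?
  count-cong {P? = P?} {Q?} P⊆Q Q⊆P =
    ≤-antisym (count-mono {P? = P?} {Q? = Q?} P⊆Q) (count-mono {P? = Q?} {Q? = P?} Q⊆P)

  count-⊎ : ∀ {N} {P Q R : Pred (Fin N) 0ℓ} {P? : Decidable P} {Q? : Decidable Q} {R? : Decidable R} →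
            P ⊆ Q ∪ R → count P? ≤ count Q? + count R?
  count-⊎ {P? = P?} {Q?} {R?} P⊆Q∪R = begin
    count P?                          ≤⟨ sum-mono-≤ (λ x → 𝟙-⊎ (P⊆Q∪R {x}) (P? x) (Q? x) (R? x)) ⟩
    sum (λ x → 𝟙 (Q? x) + 𝟙 (R? x)) ≡⟨ ∑-distrib-+ (𝟙 ∘ Q?) (𝟙 ∘ R?) ⟩
    count Q? + count R?               ∎
    where open ≤-Reasoning

  count-disjoint : ∀ {N} {P Q R : Pred (Fin N) 0ℓ} {P? : Decidable P} {Q? : Decidable Q} {R? : Decidable R} →
                   Q ⊆ P → R ⊆ P → (∀ {x} → Q x → R x → ⊥) → count Q? + count R? ≤ count P?
  count-disjoint {P? = P?} {Q?} {R?} Q⊆P R⊆P disj = begin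
    count Q? + count R?
      ≡⟨ ∑-distrib-+ (𝟙 ∘ Q?) (𝟙 ∘ R?) ⟨
    sum (λ x → 𝟙 (Q? x) + 𝟙 (R? x))
      ≤⟨ sum-mono-≤ (λ x → 𝟙-disjoint (Q⊆P {x}) (R⊆P {x}) (disj {x}) (P? x) (Q? x) (R? x)) ⟩
    count P?
      ∎
    where open ≤-Reasoning

  count-twice : ∀ {N} {P Q R S : Pred (Fin N) 0ℓ}
                {P? : Decidable P} {Q? : Decidable Q} {R? : Decidable R} {S? : Decidable S} →
                (∀ {x} → P x → AtLeastTwo (Q x) (R x) (S x)) →
                2 * count P? ≤ count Q? + count R? + count S?
  count-twice {P? = P?} {Q?} {R?} {S?} twice = begin
    2 * count P?
      ≡⟨ cong (count P? +_) (+-identityʳ _) ⟩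
    count P? + count P?
      ≡⟨ ∑-distrib-+ (𝟙 ∘ P?) (𝟙 ∘ P?) ⟨
    sum (λ x → 𝟙 (P? x) + 𝟙 (P? x))
      ≤⟨ sum-mono-≤ (λ x → 𝟙-twice (twice {x}) (P? x) (Q? x) (R? x) (S? x)) ⟩
    sum (λ x → 𝟙 (Q? x) + 𝟙 (R? x) + 𝟙 (S? x))
      ≡⟨ ∑-distrib-+ (λ x → 𝟙 (Q? x) + 𝟙 (R? x)) (𝟙 ∘ S?) ⟩
    sum (λ x → 𝟙 (Q? x) + 𝟙 (R? x)) + count S?
      ≡⟨ cong (_+ count S?) (∑-distrib-+ (𝟙 ∘ Q?) (𝟙 ∘ R?)) ⟩
    count Q? + count R? + count S?
      ∎
    where open ≤-Reasoning

  count-empty : ∀ {N} {P : Pred (Fin N) 0ℓ} {P? : Decidable P} → (∀ x → ¬ P x) → count P? ≡ 0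
  count-empty {N} {P? = P?} ∅ = n≤0⇒n≡0 (begin
    count P?        ≤⟨ sum-mono-≤ (λ x → 𝟙-mono {B = ⊥} (∅ x) (P? x) (no (λ ()))) ⟩
    sum {N} (λ _ → 0) ≡⟨ sum-replicate-zero N ⟩
    0               ∎)
    where open ≤-Reasoning

  count-singleton : ∀ {N} (a : Fin N) → count (_≟ a) ≡ 1
  count-singleton {suc N} zero    = cong suc (count-empty {N} {P? = λ x → suc x ≟ zero} (λ _ ()))
  count-singleton {suc N} (suc a) =
    trans (count-cong {P? = λ x → suc x ≟ suc a} {Q? = _≟ a} suc-injective (cong suc)) (count-singleton a)

  length-filter-tabulate : ∀ {N M} {P : Pred (Fin M) 0ℓ} (P? : Decidable P) (f : Fin N → Fin M) →
                           length (filter P? (tabulate f)) ≡ count (P? ∘ f)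
  length-filter-tabulate {zero}  P? f = refl
  length-filter-tabulate {suc N} P? f with P? (f zero)
  ... | yes _ = cong suc (length-filter-tabulate P? (f ∘ suc))
  ... | no _  = length-filter-tabulate P? (f ∘ suc)

  count-lookup : ∀ {A : Set} {P : Pred A 0ℓ} (P? : Decidable P) (xs : List A) →
                 count (λ j → P? (List.lookup xs j)) ≡ length (filter P? xs)
  count-lookup P? []       = refl
  count-lookup P? (x ∷ xs) with P? x
  ... | yes _ = cong suc (count-lookup P? xs)
  ... | no _  = count-lookup P? xs

count-subsingleton : ∀ {N} {P : Pred (Fin N) 0ℓ} {P? : Decidable P} →
                     (∀ {x y} → P x → P y → x ≡ y) → count P? ≤ 1
count-subsingleton {P? = P?} unique with any? P?
... | yes (a , Pa) = ≤-trans (count-mono (λ Px → unique Px Pa)) (≤-reflexive (count-singleton a))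
... | no ∄P        = ≤-trans (≤-reflexive (count-empty (λ x Px → ∄P (x , Px)))) z≤n

length≤count : ∀ {N} {P : Pred (Fin N) 0ℓ} {P? : Decidable P} (xs : List (Fin N)) →
               Unique xs → (∀ {x} → x ∈ xs → P x) → length xs ≤ count P?
length≤count []       _              _     = z≤n
length≤count {P = P} {P?} (a ∷ xs) (a∉xs ∷ unique) xs⊆P = begin
  suc (length xs)             ≤⟨ s≤s (length≤count {P? = P∖a?} xs unique xs⊆P∖a) ⟩
  suc (count P∖a?)            ≡⟨ cong (_+ count P∖a?) (count-singleton a) ⟨
  count (_≟ a) + count P∖a?   ≤⟨ count-disjoint (λ { refl → xs⊆P (here refl) }) proj₁
                                                 (λ { refl (_ , a≢a) → a≢a refl }) ⟩
  count P?                    ∎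
  where
  open ≤-Reasoning
  P∖a? : Decidable (λ x → P x × x ≢ a)
  P∖a? x = P? x ×-dec ¬? (x ≟ a)
  xs⊆P∖a : ∀ {x} → x ∈ xs → P x × x ≢ a
  xs⊆P∖a x∈xs = xs⊆P (there x∈xs) , λ { refl → All.lookup a∉xs x∈xs refl }

3≤count : ∀ {N} {P : Pred (Fin N) 0ℓ} {P? : Decidable P} {a b c : Fin N} →
          P a → P b → P c → a ≢ b → a ≢ c → b ≢ c → 3 ≤ count P?
3≤count Pa Pb Pc a≢b a≢c b≢c =
  length≤count (_ ∷ _ ∷ _ ∷ []) ((a≢b ∷ a≢c ∷ []) ∷ (b≢c ∷ []) ∷ [] ∷ [])
    λ { (here refl) → Pa ; (there (here refl)) → Pb ; (there (there (here refl))) → Pc }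

length-filter-allFin : ∀ {N} {P : Pred (Fin N) 0ℓ} (P? : Decidable P) → length (filter P? (allFin N)) ≡ count P?
length-filter-allFin P? = length-filter-tabulate P? (λ x → x)

-- Common targets

CommonTarget : ∀ {N} → Rel (Fin N) 0ℓ → Rel (Fin N) 0ℓ
CommonTarget _⟶_ x y = ∃ λ z → ReflClosure _⟶_ x z × ReflClosure _⟶_ y z

module _ {N : ℕ} {_⟶_ : Rel (Fin N) 0ℓ} (_⟶?_ : ∀ x y → Dec (x ⟶ y)) where

  private
    _⟶⁼_ : Rel (Fin N) 0ℓ
    _⟶⁼_ = ReflClosure _⟶_

  ReflClosure? : ∀ x y → Dec (x ⟶⁼ y)
  ReflClosure? x y with x ≟ y | x ⟶? y
  ... | yes refl | _       = yes refl
  ... | no _     | yes x⟶y = yes [ x⟶y ]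
  ... | no x≢y   | no ¬x⟶y = no λ { refl → x≢y refl ; [ x⟶y ] → ¬x⟶y x⟶y }

  module _ {T : Pred (Fin N) 0ℓ} (T? : Decidable T) where

    private
      common? : ∀ z → Dec (∀ y → T y → y ⟶⁼ z)
      common? z = all? λ y → T? y →-dec ReflClosure? y z

      counterexample : ∀ {z} → ¬ (∀ y → T y → y ⟶⁼ z) → ∃ λ y → T y × ¬ y ⟶⁼ z
      counterexample {z} ¬all with ¬∀⟶∃¬ N _ (λ y → T? y →-dec ReflClosure? y z) ¬all
      ... | y , ¬[Ty⇒y⟶⁼z] with T? y
      ...   | yes Ty = y , Ty , λ y⟶⁼z → ¬[Ty⇒y⟶⁼z] (λ _ → y⟶⁼z)
      ...   | no ¬Ty = ⊥-elim (¬[Ty⇒y⟶⁼z] (λ Ty → ⊥-elim (¬Ty Ty)))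

    -- Each x ∈ T has the target set {x, f x} of size at most two.  Pairwise intersecting
    -- such sets share a point unless three of them form a triangle, which would be a 3-cycle.
    pairwise⇒common-target :
      (∀ {x a b} → T x → x ⟶ a → x ⟶ b → a ≡ b) →
      (∀ {a b c} → a ⟶ b → b ⟶ c → c ⟶ a → ⊥) →
      (∀ {x y} → T x → T y → CommonTarget _⟶_ x y) →
      ∀ {x₀} → T x₀ → ∃ λ z → ∀ {y} → T y → y ⟶⁼ z
    pairwise⇒common-target functional acyclic₃ pairwise {x₀} Tx₀ with common? x₀
    ... | yes all⟶x₀ = x₀ , all⟶x₀ _
    ... | no ¬all with counterexample ¬all
    ...   | y₁ , Ty₁ , y₁↛x₀ with pairwise Tx₀ Ty₁
    ...     | _  , refl , y₁⟶x₀ = ⊥-elim (y₁↛x₀ y₁⟶x₀)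
    ...     | z₁ , [ x₀⟶z₁ ] , y₁⟶⁼z₁ with common? z₁
    ...       | yes all⟶z₁ = z₁ , all⟶z₁ _
    ...       | no ¬all′ with counterexample ¬all′
    ...         | y₂ , Ty₂ , y₂↛z₁ = triangle y₁⟶⁼z₁ y₁⟶y₂
      where
      y₂⟶x₀ : y₂ ⟶ x₀
      y₂⟶x₀ with pairwise Tx₀ Ty₂
      ... | _ , [ x₀⟶z₂ ] , y₂⟶⁼z₂ rewrite functional Tx₀ x₀⟶z₂ x₀⟶z₁ =
        ⊥-elim (y₂↛z₁ y₂⟶⁼z₂)
      ... | _ , refl , refl        = ⊥-elim (y₂↛z₁ [ x₀⟶z₁ ])
      ... | _ , refl , [ y₂⟶x₀ ] = y₂⟶x₀

      y₁⟶y₂ : y₁ ⟶ y₂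
      y₁⟶y₂ with pairwise Ty₁ Ty₂
      ... | _ , y₁⟶⁼c , [ y₂⟶c ] rewrite functional Ty₂ y₂⟶c y₂⟶x₀ =
        ⊥-elim (y₁↛x₀ y₁⟶⁼c)
      ... | _ , refl , refl        = ⊥-elim (y₁↛x₀ [ y₂⟶x₀ ])
      ... | _ , [ y₁⟶y₂ ] , refl = y₁⟶y₂

      triangle : y₁ ⟶⁼ z₁ → y₁ ⟶ y₂ → ∃ λ z → ∀ {y} → T y → y ⟶⁼ z
      triangle refl        y₁⟶y₂ = ⊥-elim (acyclic₃ x₀⟶z₁ y₁⟶y₂ y₂⟶x₀)
      triangle [ y₁⟶z₁ ] y₁⟶y₂ =
        ⊥-elim (y₂↛z₁ (subst (y₂ ⟶⁼_) (functional Ty₁ y₁⟶y₂ y₁⟶z₁) refl))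

-- Hub classes

others : (m : Fin 3) → ∃₂ λ j k → j ≢ k × j ≢ m × k ≢ m
others 0F = 1F , 2F , (λ ()) , (λ ()) , (λ ())
others 1F = 0F , 2F , (λ ()) , (λ ()) , (λ ())
others 2F = 0F , 1F , (λ ()) , (λ ()) , (λ ())

third : {j k : Fin 3} → j ≢ k → ∃ λ l → l ≢ j × l ≢ k × ∀ m → m ≡ j ⊎ m ≡ k ⊎ m ≡ l
third {0F} {0F} j≢k = ⊥-elim (j≢k refl)
third {0F} {1F} _ = 2F , (λ ()) , (λ ()) , λ { 0F → inj₁ refl ; 1F → inj₂ (inj₁ refl) ; 2F → inj₂ (inj₂ refl) }
third {0F} {2F} _ = 1F , (λ ()) , (λ ()) , λ { 0F → inj₁ refl ; 2F → inj₂ (inj₁ refl) ; 1F → inj₂ (inj₂ refl) }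
third {1F} {0F} _ = 2F , (λ ()) , (λ ()) , λ { 1F → inj₁ refl ; 0F → inj₂ (inj₁ refl) ; 2F → inj₂ (inj₂ refl) }
third {1F} {1F} j≢k = ⊥-elim (j≢k refl)
third {1F} {2F} _ = 0F , (λ ()) , (λ ()) , λ { 1F → inj₁ refl ; 2F → inj₂ (inj₁ refl) ; 0F → inj₂ (inj₂ refl) }
third {2F} {0F} _ = 1F , (λ ()) , (λ ()) , λ { 2F → inj₁ refl ; 0F → inj₂ (inj₁ refl) ; 1F → inj₂ (inj₂ refl) }
third {2F} {1F} _ = 0F , (λ ()) , (λ ()) , λ { 2F → inj₁ refl ; 1F → inj₂ (inj₁ refl) ; 0F → inj₂ (inj₂ refl) }
third {2F} {2F} j≢k = ⊥-elim (j≢k refl)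

-- The situation at a sink v of a clique of P(D): U is the rest of the clique, H m the part of U
-- sending an arc to the m-th hub (v or one of its out-neighbours), and x ⟶ z an arc into a non-hub.
record HubClasses (N i : ℕ) : Set₁ where
  field
    U                 : Pred (Fin N) 0ℓ
    U?                : Decidable U
    H                 : Fin 3 → Pred (Fin N) 0ℓ
    H?                : ∀ m → Decidable (H m)
    _⟶_               : Rel (Fin N) 0ℓ
    _⟶?_              : ∀ x y → Dec (x ⟶ y)
    H⊆U               : ∀ {m x} → H m x → U x
    covered           : ∀ {x} → U x → ∃ λ m → H m x
    ¬all-classes      : ∀ {x} → U x → ¬ (∀ m → H m x)
    class≤            : ∀ m → count (H? m) ≤ i
    two-classes<      : ∀ {j k} → j ≢ k → count (H? j) + count (H? k) < i + i
    adjacent          : ∀ {x y} → U x → U y → x ≢ y → (∀ m → H m x → H m y → ⊥) →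
                        CommonTarget _⟶_ x y
    two-classes⇒¬⟶    : ∀ {x j k z} → j ≢ k → H j x → H k x → ¬ x ⟶ z
    ⟶-functional      : ∀ {x a b} → U x → x ⟶ a → x ⟶ b → a ≡ b
    in-links≤         : ∀ z → count (λ x → x ⟶? z) ≤ i
    ⟶-¬3-cycle        : ∀ {a b c} → a ⟶ b → b ⟶ c → c ⟶ a → ⊥

i+i+i≡3*i : ∀ i → i + i + i ≡ 3 * i
i+i+i≡3*i = solve-∀

≤i+2⇒2*≤3* : ∀ {c i} → 4 ≤ i → c ≤ i + 2 → 2 * c ≤ 3 * i
≤i+2⇒2*≤3* {c} {i} 4≤i c≤i+2 = begin
  2 * c        ≤⟨ *-monoʳ-≤ 2 c≤i+2 ⟩
  2 * (i + 2)  ≡⟨ expand i ⟩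
  i + i + 4    ≤⟨ +-monoʳ-≤ (i + i) 4≤i ⟩
  i + i + i    ≡⟨ i+i+i≡3*i i ⟩
  3 * i        ∎
  where
  open ≤-Reasoning
  expand : ∀ i → 2 * (i + 2) ≡ i + i + 4
  expand = solve-∀

suc-i≤i+2 : ∀ i → suc i ≤ i + 2
suc-i≤i+2 i = ≤-trans (n≤1+n (suc i)) (≤-reflexive (+-comm 2 i))

module HubClassesBound {N i : ℕ} (S : HubClasses N i) where
  open HubClasses S

  _⟶⁼_ : Rel (Fin N) 0ℓ
  _⟶⁼_ = ReflClosure _⟶_

  _⟶⁼?_ : ∀ x y → Dec (x ⟶⁼ y)
  _⟶⁼?_ = ReflClosure? _⟶?_

  ⟶⁼-≢⇒⟶ : ∀ {x y} → x ≢ y → x ⟶⁼ y → x ⟶ y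
  ⟶⁼-≢⇒⟶ x≢y refl      = ⊥-elim (x≢y refl)
  ⟶⁼-≢⇒⟶ x≢y [ x⟶y ] = x⟶y

  Apart : Rel (Fin N) 0ℓ
  Apart x y = ∀ m → H m x → H m y → ⊥

  Single : Fin 3 → Pred (Fin N) 0ℓ
  Single m x = H m x × (∀ m′ → H m′ x → m′ ≡ m)

  Double : Fin 3 → Pred (Fin N) 0ℓ
  Double m x = U x × ¬ H m x × (∀ m′ → m′ ≢ m → H m′ x)

  Single? : ∀ m → Decidable (Single m)
  Single? m x = H? m x ×-dec all? (λ m′ → H? m′ x →-dec (m′ ≟ m))

  Double? : ∀ m → Decidable (Double m)
  Double? m x = U? x ×-dec ¬? (H? m x) ×-dec all? (λ m′ → ¬? (m′ ≟ m) →-dec H? m′ x)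

  classify : ∀ {x} → U x → (∃ λ m → Single m x) ⊎ (∃ λ m → Double m x)
  classify {x} Ux with covered Ux
  ... | j , Hjx with all? (λ m → H? m x →-dec (m ≟ j))
  ...   | yes only-j = inj₁ (j , Hjx , only-j)
  ...   | no ¬only-j with ¬∀⟶∃¬ 3 _ (λ m → H? m x →-dec (m ≟ j)) ¬only-j
  ...     | k , ¬[Hk⇒k≡j] with H? k x | k ≟ j
  ...       | no ¬Hkx | _        = ⊥-elim (¬[Hk⇒k≡j] (λ Hkx → ⊥-elim (¬Hkx Hkx)))
  ...       | yes _   | yes k≡j  = ⊥-elim (¬[Hk⇒k≡j] (λ _ → k≡j))
  ...       | yes Hkx | no k≢j with third (k≢j ∘ sym)
  ...         | l , l≢j , l≢k , exhaustive =
                inj₂ (l , Ux , (λ Hlx → ¬all-classes Ux (in-all Hlx)) , λ m m≢l → in-all-but-l m m≢l)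
    where
    in-all : H l x → ∀ m → H m x
    in-all Hlx m with exhaustive m
    ... | inj₁ refl        = Hjx
    ... | inj₂ (inj₁ refl) = Hkx
    ... | inj₂ (inj₂ refl) = Hlx
    in-all-but-l : ∀ m → m ≢ l → H m x
    in-all-but-l m m≢l with exhaustive m
    ... | inj₁ refl        = Hjx
    ... | inj₂ (inj₁ refl) = Hkx
    ... | inj₂ (inj₂ refl) = ⊥-elim (m≢l refl)

  single-unique : ∀ {m m′ x} → Single m x → Single m′ x → m ≡ m′
  single-unique (Hmx , _) (_ , only-m′) = only-m′ _ Hmx

  Double⇒¬⟶ : ∀ {m x z} → Double m x → ¬ x ⟶ z
  Double⇒¬⟶ {m} (_ , _ , in-others) with others m
  ... | j , k , j≢k , j≢m , k≢m = two-classes⇒¬⟶ j≢k (in-others j j≢m) (in-others k k≢m)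

  single-double-apart : ∀ {m x y} → Single m x → Double m y → Apart x y
  single-double-apart (_ , only-m) (_ , ¬Hmy , _) m′ Hm′x Hm′y rewrite only-m m′ Hm′x = ¬Hmy Hm′y

  singles-apart : ∀ {j k x y} → j ≢ k → Single j x → Single k y → Apart x y
  singles-apart j≢k (_ , only-j) (_ , only-k) m Hmx Hmy = j≢k (trans (sym (only-j m Hmx)) (only-k m Hmy))

  single⟶double : ∀ {m x y} → Single m x → Double m y → x ⟶ y
  single⟶double sx@(Hmx , _) dy@(Uy , ¬Hmy , _)
    with adjacent (H⊆U Hmx) Uy (λ { refl → ¬Hmy Hmx }) (single-double-apart sx dy)
  ... | _ , _        , [ y⟶z ] = ⊥-elim (Double⇒¬⟶ dy y⟶z)
  ... | _ , refl     , refl      = ⊥-elim (¬Hmy Hmx)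
  ... | _ , [ x⟶y ] , refl      = x⟶y

  doubles≤1 : ∀ {m x} → Single m x → count (Double? m) ≤ 1
  doubles≤1 sx = count-subsingleton λ dy dy′ →
    ⟶-functional (H⊆U (proj₁ sx)) (single⟶double sx dy) (single⟶double sx dy′)

  out-links≤1 : ∀ {x} → U x → count (x ⟶?_) ≤ 1
  out-links≤1 Ux = count-subsingleton (⟶-functional Ux)

  reaching≤ : ∀ z → count (_⟶⁼? z) ≤ suc i
  reaching≤ z = begin
    count (_⟶⁼? z)                       ≤⟨ count-⊎ (λ { refl → inj₁ refl ; [ y⟶z ] → inj₂ y⟶z }) ⟩
    count (_≟ z) + count (λ y → y ⟶? z)  ≤⟨ +-mono-≤ (≤-reflexive (count-singleton z)) (in-links≤ z) ⟩
    suc i                                 ∎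
    where open ≤-Reasoning

  no-singles : (∀ {m x} → ¬ Single m x) → 2 * count U? ≤ 3 * i
  no-singles ∄single = begin
    2 * count U?                                   ≤⟨ count-twice in-two-classes ⟩
    count (H? 0F) + count (H? 1F) + count (H? 2F)
      ≤⟨ +-mono-≤ (+-mono-≤ (class≤ 0F) (class≤ 1F)) (class≤ 2F) ⟩
    i + i + i                                      ≡⟨ i+i+i≡3*i i ⟩
    3 * i                                          ∎
    where
    open ≤-Reasoning
    in-two-classes : ∀ {x} → U x → AtLeastTwo (H 0F x) (H 1F x) (H 2F x)
    in-two-classes Ux with classify Ux
    ... | inj₁ (_ , sx)              = ⊥-elim (∄single sx)
    ... | inj₂ (0F , _ , _ , in-others) = inj₂ (inj₂ (in-others 1F (λ ()) , in-others 2F (λ ())))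
    ... | inj₂ (1F , _ , _ , in-others) = inj₂ (inj₁ (in-others 0F (λ ()) , in-others 2F (λ ())))
    ... | inj₂ (2F , _ , _ , in-others) = inj₁ (in-others 0F (λ ()) , in-others 1F (λ ()))

  singles-in-one-class : ∀ {j x} → Single j x → (∀ {m y} → m ≢ j → ¬ Single m y) → count U? ≤ suc i
  singles-in-one-class {j} sx only-j = begin
    count U?                          ≤⟨ count-⊎ in-j-or-double ⟩
    count (H? j) + count (Double? j)  ≤⟨ +-mono-≤ (class≤ j) (doubles≤1 sx) ⟩
    i + 1                             ≡⟨ +-comm i 1 ⟩
    suc i                             ∎
    where
    open ≤-Reasoning
    in-j-or-double : ∀ {y} → U y → H j y ⊎ Double j y
    in-j-or-double Uy with classify Uy
    ... | inj₁ (m , sy) with m ≟ j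
    ...   | yes refl = inj₁ (proj₁ sy)
    ...   | no m≢j   = ⊥-elim (only-j m≢j sy)
    in-j-or-double Uy | inj₂ (m , dy) with m ≟ j
    ...   | yes refl = inj₂ dy
    ...   | no m≢j   = inj₁ (proj₂ (proj₂ dy) j (m≢j ∘ sym))

  same-class-without-common-target : ∀ {m x x′} → Single m x → Single m x′ →
                                     ¬ CommonTarget _⟶_ x x′ → count U? ≤ i + 2
  same-class-without-common-target {m} {x} {x′} sx sx′ no-target = begin
    count U?
      ≤⟨ count-⊎ {Q? = H? m} cover ⟩
    count (H? m) + count (λ y → x ⟶? y ⊎-dec x′ ⟶? y)
      ≤⟨ +-monoʳ-≤ (count (H? m)) (count-⊎ (λ x⟶y⊎x′⟶y → x⟶y⊎x′⟶y)) ⟩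
    count (H? m) + (count (x ⟶?_) + count (x′ ⟶?_))
      ≤⟨ +-mono-≤ (class≤ m) (+-mono-≤ (out-links≤1 Ux) (out-links≤1 Ux′)) ⟩
    i + 2
      ∎
    where
    open ≤-Reasoning
    Ux  = H⊆U (proj₁ sx)
    Ux′ = H⊆U (proj₁ sx′)
    via-targets : ∀ {y} → U y → x ≢ y → x′ ≢ y →
                  CommonTarget _⟶_ x y → CommonTarget _⟶_ x′ y → x ⟶ y ⊎ x′ ⟶ y
    via-targets _ x≢y _ (_ , x⟶⁼y , refl) _ = inj₁ (⟶⁼-≢⇒⟶ x≢y x⟶⁼y)
    via-targets _ _ x′≢y _ (_ , x′⟶⁼y , refl) = inj₂ (⟶⁼-≢⇒⟶ x′≢y x′⟶⁼y)
    via-targets Uy _ _ (z , x⟶⁼z , [ y⟶z ]) (_ , x′⟶⁼z′ , [ y⟶z′ ]) =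
      ⊥-elim (no-target (z , x⟶⁼z , subst (x′ ⟶⁼_) (⟶-functional Uy y⟶z′ y⟶z) x′⟶⁼z′))
    cover : ∀ {y} → U y → H m y ⊎ (x ⟶ y ⊎ x′ ⟶ y)
    cover Uy with classify Uy
    ... | inj₂ (m′ , dy) with m′ ≟ m
    ...   | yes refl = ⊥-elim (no-target (_ , [ single⟶double sx dy ] , [ single⟶double sx′ dy ]))
    ...   | no m′≢m  = inj₁ (proj₂ (proj₂ dy) m (m′≢m ∘ sym))
    cover Uy | inj₁ (m′ , sy) with m′ ≟ m
    ...   | yes refl = inj₁ (proj₁ sy)
    ...   | no m′≢m  = inj₂ (via-targets Uy x≢y x′≢y
                                (adjacent Ux Uy x≢y (singles-apart (m′≢m ∘ sym) sx sy))
                                (adjacent Ux′ Uy x′≢y (singles-apart (m′≢m ∘ sym) sx′ sy)))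
      where
      x≢y : x ≢ _
      x≢y refl = m′≢m (single-unique sy sx)
      x′≢y : x′ ≢ _
      x′≢y refl = m′≢m (single-unique sy sx′)

  module _ (z : Fin N) (singles⟶⁼z : ∀ {m x} → Single m x → x ⟶⁼ z) where

    single-is-target : ∀ {m x y} → Double m y → ¬ y ⟶⁼ z → Single m x → x ≡ z
    single-is-target dy y↛z sx with singles⟶⁼z sx
    ... | refl      = refl
    ... | [ x⟶z ] = ⊥-elim (y↛z (reflexive (⟶-functional (H⊆U (proj₁ sx)) (single⟶double sx dy) x⟶z)))

    all-classes-single : (∀ m → ∃ (Single m)) → count U? ≤ i + 2
    all-classes-single occupied = begin
      count U?
        ≤⟨ count-⊎ targets-or-misses ⟩
      count (_⟶⁼? z) + count (λ y → U? y ×-dec ¬? (y ⟶⁼? z))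
        ≤⟨ +-mono-≤ (reaching≤ z) (count-subsingleton misses-unique) ⟩
      suc i + 1
        ≡⟨ +-suc i 1 ⟨
      i + 2
        ∎
      where
      open ≤-Reasoning
      targets-or-misses : ∀ {y} → U y → y ⟶⁼ z ⊎ (U y × ¬ y ⟶⁼ z)
      targets-or-misses {y} Uy with y ⟶⁼? z
      ... | yes y⟶⁼z = inj₁ y⟶⁼z
      ... | no y↛z   = inj₂ (Uy , y↛z)
      miss⇒double : ∀ {y} → U y → ¬ y ⟶⁼ z → ∃ λ m → Double m y
      miss⇒double Uy y↛z with classify Uy
      ... | inj₁ (_ , sy) = ⊥-elim (y↛z (singles⟶⁼z sy))
      ... | inj₂ d        = d
      misses-unique : ∀ {y y′} → U y × ¬ y ⟶⁼ z → U y′ × ¬ y′ ⟶⁼ z → y ≡ y′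
      misses-unique (Uy , y↛z) (Uy′ , y′↛z) with miss⇒double Uy y↛z | miss⇒double Uy′ y′↛z
      ... | m , dy | m′ , dy′ with occupied m | occupied m′
      ... | _ , sx | _ , sx′ with single-is-target dy y↛z sx | single-is-target dy′ y′↛z sx′
      ... | refl | refl with single-unique sx sx′
      ... | refl = ⟶-functional (H⊆U (proj₁ sx)) (single⟶double sx dy) (single⟶double sx dy′)

    module _ {j k l : Fin 3} (j≢k : j ≢ k) (l≢j : l ≢ j) (l≢k : l ≢ k)
             (exhaustive : ∀ m → m ≡ j ⊎ m ≡ k ⊎ m ≡ l)
             (∄single-l : ∀ {x} → ¬ Single l x) where

      double-missing-target : ∀ {xj xk y} → Single j xj → Single k xk → Double j y → ¬ y ⟶⁼ z →
                              count U? ≤ suc i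
      double-missing-target {xk = xk} sxj sxk dy y↛z = begin
        count U?                    ≤⟨ count-⊎ in-k-or-target ⟩
        count (H? k) + count (_≟ z) ≤⟨ +-mono-≤ (class≤ k) (≤-reflexive (count-singleton z)) ⟩
        i + 1                       ≡⟨ +-comm i 1 ⟩
        suc i                       ∎
        where
        open ≤-Reasoning
        xk⟶z : xk ⟶ z
        xk⟶z with singles⟶⁼z sxk
        ... | [ xk⟶z ] = xk⟶z
        ... | refl      = ⊥-elim (j≢k (single-unique (subst (Single j) (single-is-target dy y↛z sxj) sxj) sxk))
        in-k-or-target : ∀ {x} → U x → H k x ⊎ x ≡ z
        in-k-or-target Ux with classify Ux
        ... | inj₁ (m , sx) with exhaustive m
        ...   | inj₁ refl        = inj₂ (single-is-target dy y↛z sx)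
        ...   | inj₂ (inj₁ refl) = inj₁ (proj₁ sx)
        ...   | inj₂ (inj₂ refl) = ⊥-elim (∄single-l sx)
        in-k-or-target Ux | inj₂ (m , dx) with m ≟ k
        ...   | yes refl = inj₂ (⟶-functional (H⊆U (proj₁ sxk)) (single⟶double sxk dx) xk⟶z)
        ...   | no m≢k   = inj₁ (proj₂ (proj₂ dx) k (m≢k ∘ sym))

      doubles-on-target : (∀ {y} → Double j y ⊎ Double k y → y ⟶⁼ z) → 2 * count U? ≤ 3 * i
      doubles-on-target doubles⟶⁼z = begin
        2 * count U?                                  ≤⟨ count-twice in-two ⟩
        count (H? j) + count (H? k) + count (_⟶⁼? z)  ≤⟨ +-monoʳ-≤ _ (reaching≤ z) ⟩
        count (H? j) + count (H? k) + suc i           ≡⟨ +-suc _ i ⟩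
        suc (count (H? j) + count (H? k)) + i         ≤⟨ +-monoˡ-≤ i (two-classes< j≢k) ⟩
        i + i + i                                     ≡⟨ i+i+i≡3*i i ⟩
        3 * i                                         ∎
        where
        open ≤-Reasoning
        in-two : ∀ {x} → U x → AtLeastTwo (H j x) (H k x) (x ⟶⁼ z)
        in-two Ux with classify Ux
        ... | inj₁ (m , sx) with exhaustive m
        ...   | inj₁ refl        = inj₂ (inj₁ (proj₁ sx , singles⟶⁼z sx))
        ...   | inj₂ (inj₁ refl) = inj₂ (inj₂ (proj₁ sx , singles⟶⁼z sx))
        ...   | inj₂ (inj₂ refl) = ⊥-elim (∄single-l sx)
        in-two Ux | inj₂ (m , dx@(_ , _ , in-others)) with exhaustive m
        ...   | inj₁ refl        = inj₂ (inj₂ (in-others k (j≢k ∘ sym) , doubles⟶⁼z (inj₁ dx)))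
        ...   | inj₂ (inj₁ refl) = inj₂ (inj₁ (in-others j j≢k , doubles⟶⁼z (inj₂ dx)))
        ...   | inj₂ (inj₂ refl) = inj₁ (in-others j (l≢j ∘ sym) , in-others k (l≢k ∘ sym))

    two-classes-single : 4 ≤ i → ∀ {j k xj xk} → j ≢ k → Single j xj → Single k xk → 2 * count U? ≤ 3 * i
    two-classes-single 4≤i {j} {k} j≢k sxj sxk with third j≢k
    ... | l , l≢j , l≢k , exhaustive with any? (Single? l)
    ...   | yes sxl = ≤i+2⇒2*≤3* 4≤i (all-classes-single occupied)
      where
      occupied : ∀ m → ∃ (Single m)
      occupied m with exhaustive m
      ... | inj₁ refl        = _ , sxj
      ... | inj₂ (inj₁ refl) = _ , sxk
      ... | inj₂ (inj₂ refl) = sxl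
    ...   | no ∄l with any? (λ y → (Double? j y ⊎-dec Double? k y) ×-dec ¬? (y ⟶⁼? z))
    ...     | yes (_ , inj₁ dy , y↛z) = ≤i+2⇒2*≤3* 4≤i (≤-trans
                (double-missing-target j≢k l≢j l≢k exhaustive ∄single-l sxj sxk dy y↛z) (suc-i≤i+2 i))
      where
      ∄single-l : ∀ {x} → ¬ Single l x
      ∄single-l sx = ∄l (_ , sx)
    ...     | yes (_ , inj₂ dy , y↛z) = ≤i+2⇒2*≤3* 4≤i (≤-trans
                (double-missing-target (j≢k ∘ sym) l≢k l≢j swapped ∄single-l sxk sxj dy y↛z) (suc-i≤i+2 i))
      where
      ∄single-l : ∀ {x} → ¬ Single l x
      ∄single-l sx = ∄l (_ , sx)
      swapped : ∀ m → m ≡ k ⊎ m ≡ j ⊎ m ≡ l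
      swapped m with exhaustive m
      ... | inj₁ m≡j        = inj₂ (inj₁ m≡j)
      ... | inj₂ (inj₁ m≡k) = inj₁ m≡k
      ... | inj₂ (inj₂ m≡l) = inj₂ (inj₂ m≡l)
    ...     | no ∄miss = doubles-on-target j≢k l≢j l≢k exhaustive (λ sx → ∄l (_ , sx)) on-target
      where
      on-target : ∀ {y} → Double j y ⊎ Double k y → y ⟶⁼ z
      on-target {y} d with y ⟶⁼? z
      ... | yes y⟶⁼z = y⟶⁼z
      ... | no y↛z   = ⊥-elim (∄miss (y , d , y↛z))

  common-target? : ∀ x y → Dec (CommonTarget _⟶_ x y)
  common-target? x y = any? λ z → x ⟶⁼? z ×-dec y ⟶⁼? z

  IsSingle : Pred (Fin N) 0ℓ
  IsSingle x = ∃ λ m → Single m x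

  singles-pairwise : (∀ {m x x′} → Single m x → Single m x′ → CommonTarget _⟶_ x x′) →
                     ∀ {x y} → IsSingle x → IsSingle y → CommonTarget _⟶_ x y
  singles-pairwise same-class (j , sx) (k , sy) with j ≟ k
  ... | yes refl = same-class sx sy
  ... | no j≢k   = adjacent (H⊆U (proj₁ sx)) (H⊆U (proj₁ sy)) (λ { refl → j≢k (single-unique sx sy) })
                            (singles-apart j≢k sx sy)

  2*count≤3*i : 4 ≤ i → 2 * count U? ≤ 3 * i
  2*count≤3*i 4≤i with any? (λ m → any? (Single? m))
  ... | no ∄single = no-singles (λ sx → ∄single (_ , _ , sx))
  ... | yes (j , _ , sxj) with any? (λ m → ¬? (m ≟ j) ×-dec any? (Single? m))
  ...   | no ∄other = ≤i+2⇒2*≤3* 4≤i (≤-trans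
                        (singles-in-one-class sxj (λ m≢j sy → ∄other (_ , m≢j , _ , sy))) (suc-i≤i+2 i))
  ...   | yes (k , k≢j , _ , sxk)
          with any? (λ m → any? λ x → any? λ x′ →
                       Single? m x ×-dec Single? m x′ ×-dec ¬? (common-target? x x′))
  ...     | yes (_ , _ , _ , sx , sx′ , apart) = ≤i+2⇒2*≤3* 4≤i (same-class-without-common-target sx sx′ apart)
  ...     | no ∄apart with pairwise⇒common-target _⟶?_ (λ x → any? (λ m → Single? m x))
                             (λ (_ , sx) → ⟶-functional (H⊆U (proj₁ sx))) ⟶-¬3-cycle
                             (singles-pairwise same-class) (j , sxj)
    where
    same-class : ∀ {m x x′} → Single m x → Single m x′ → CommonTarget _⟶_ x x′
    same-class {m} {x} {x′} sx sx′ with common-target? x x′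
    ... | yes common = common
    ... | no apart   = ⊥-elim (∄apart (m , x , x′ , sx , sx′ , apart))
  ...       | z , singles⟶⁼z = two-classes-single z (λ sx → singles⟶⁼z (_ , sx)) 4≤i (k≢j ∘ sym) sxj sxk

-- Digraphs of bounded degree

module _ {n : ℕ} (D : Digraph n) where

  Arc? : ∀ u v → Dec (Arc D u v)
  Arc? u v = T? (D u v)

  indeg≡count : ∀ v → indeg D v ≡ count (λ u → Arc? u v)
  indeg≡count v = length-filter-allFin (λ u → Arc? u v)

  outdeg≡count : ∀ u → outdeg D u ≡ count (Arc? u)
  outdeg≡count u = length-filter-allFin (Arc? u)

  outdeg≤2⇒¬3-out : ∀ {x a b c} → outdeg D x ≤ 2 →
                    Arc D x a → Arc D x b → Arc D x c → a ≢ b → a ≢ c → b ≢ c → ⊥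
  outdeg≤2⇒¬3-out {x} outdeg≤2 x⟶a x⟶b x⟶c a≢b a≢c b≢c
    with ≤-trans (3≤count {P? = Arc? x} x⟶a x⟶b x⟶c a≢b a≢c b≢c)
                 (≤-trans (≤-reflexive (sym (outdeg≡count x))) outdeg≤2)
  ... | s≤s (s≤s ())

  successors⇒cycle : {K : Pred (Fin n) 0ℓ} → (∀ {x} → K x → ∃ λ y → K y × Arc D x y) →
                     ∀ {x₀} → K x₀ → ∃ λ v → TransClosure (Arc D) v v
  successors⇒cycle {K} next {x₀} Kx₀ =
    let p , q , p<q , same-vertex = pigeonhole (n<1+n n) (proj₁ ∘ walk ∘ toℕ)
    in  _ , subst (TransClosure (Arc D) _) (sym same-vertex) (path-to-later p<q)
    where
    walk : ℕ → Σ (Fin n) K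
    walk zero    = x₀ , Kx₀
    walk (suc t) = proj₁ (next (proj₂ (walk t))) , proj₁ (proj₂ (next (proj₂ (walk t))))

    path : ∀ s k → TransClosure (Arc D) (proj₁ (walk s)) (proj₁ (walk (suc k + s)))
    path s zero    = Plus.[ proj₂ (proj₂ (next (proj₂ (walk s)))) ]
    path s (suc k) = path s k Plus.∷ʳ proj₂ (proj₂ (next (proj₂ (walk (suc k + s)))))

    path-to-later : ∀ {s t} → s < t → TransClosure (Arc D) (proj₁ (walk s)) (proj₁ (walk t))
    path-to-later {s} s<t with m≤n⇒∃[o]m+o≡n s<t
    ... | o , refl =
      subst (λ t → TransClosure (Arc D) (proj₁ (walk s)) (proj₁ (walk t))) (cong suc (+-comm o s)) (path s o)

ranked⇒acyclic : ∀ {n} {D : Digraph n} (rank : Fin n → ℕ) →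
                 (∀ {x y} → Arc D x y → rank y < rank x) → Acyclic D
ranked⇒acyclic {D = D} rank descends x cycle = <-irrefl refl (descends⁺ cycle)
  where
  descends⁺ : ∀ {x y} → TransClosure (Arc D) x y → rank y < rank x
  descends⁺ Plus.[ x⟶y ]      = descends x⟶y
  descends⁺ (x⟶y Plus.∷ y⟶⁺z) = <-trans (descends⁺ y⟶⁺z) (descends x⟶y)

module _ {n : ℕ} {D : Digraph n} (acyclic : Acyclic D) where

  ¬loop : ∀ {x} → ¬ Arc D x x
  ¬loop x⟶x = acyclic _ Plus.[ x⟶x ]

  ¬3-cycle : ∀ {a b c} → Arc D a b → Arc D b c → Arc D c a → ⊥
  ¬3-cycle a⟶b b⟶c c⟶a = acyclic _ (a⟶b Plus.∷ b⟶c Plus.∷ Plus.[ c⟶a ])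

  sink : {K : Pred (Fin n) 0ℓ} → Decidable K → ∀ {x₀} → K x₀ →
         ∃ λ v → K v × ∀ {y} → K y → ¬ Arc D v y
  sink {K} K? Kx₀ with any? (λ v → K? v ×-dec ¬? (any? λ y → K? y ×-dec Arc? D v y))
  ... | yes (v , Kv , ∄out) = v , Kv , λ Ky v⟶y → ∄out (_ , Ky , v⟶y)
  ... | no ∄sink = ⊥-elim (acyclic _ (proj₂ (successors⇒cycle D next Kx₀)))
    where
    next : ∀ {x} → K x → ∃ λ y → K y × Arc D x y
    next {x} Kx with any? (λ y → K? y ×-dec Arc? D x y)
    ... | yes out = out
    ... | no ∄out = ⊥-elim (∄sink (x , Kx , ∄out))

record OutCover {n : ℕ} (D : Digraph n) (v : Fin n) : Set where
  field
    h₁ h₂    : Fin n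
    covers   : ∀ {w} → Arc D v w → w ≡ h₁ ⊎ w ≡ h₂
    distinct : Arc D v h₁ → Arc D v h₂ → h₁ ≢ h₂

out-cover : ∀ {n} {D : Digraph n} {v} → Acyclic D → outdeg D v ≤ 2 → OutCover D v
out-cover {D = D} {v} acyclic outdeg≤2 with any? (Arc? D v)
... | no ∄w = record
  { h₁ = v ; h₂ = v
  ; covers = λ v⟶w → ⊥-elim (∄w (_ , v⟶w))
  ; distinct = λ v⟶v → ⊥-elim (¬loop acyclic v⟶v) }
... | yes (w₁ , v⟶w₁) with any? (λ w → Arc? D v w ×-dec ¬? (w ≟ w₁))
...   | no ∄w₂ = record
  { h₁ = w₁ ; h₂ = v
  ; covers = λ {w} v⟶w → inj₁ (decidable-stable (w ≟ w₁) λ w≢w₁ → ∄w₂ (w , v⟶w , w≢w₁))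
  ; distinct = λ _ v⟶v → ⊥-elim (¬loop acyclic v⟶v) }
...   | yes (w₂ , v⟶w₂ , w₂≢w₁) = record
  { h₁ = w₁ ; h₂ = w₂ ; covers = covers ; distinct = λ _ _ → w₂≢w₁ ∘ sym }
  where
  covers : ∀ {w} → Arc D v w → w ≡ w₁ ⊎ w ≡ w₂
  covers {w} v⟶w with w ≟ w₁ | w ≟ w₂
  ... | yes w≡w₁ | _        = inj₁ w≡w₁
  ... | no _     | yes w≡w₂ = inj₂ w≡w₂
  ... | no w≢w₁  | no w≢w₂  =
    ⊥-elim (outdeg≤2⇒¬3-out D outdeg≤2 v⟶w₁ v⟶w₂ v⟶w (w₂≢w₁ ∘ sym) (w≢w₁ ∘ sym) (w≢w₂ ∘ sym))

-- Cliques of phylogeny graphs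

module CliqueAtSink {n i : ℕ} {D : Digraph n} (ij : IsIJDigraph i 2 D) (4≤i : 4 ≤ i)
  {K : Pred (Fin n) 0ℓ} (K? : Decidable K) (clique : ∀ {x y} → K x → K y → x ≢ y → PAdj D x y)
  {v : Fin n} (Kv : K v) (v-sink : ∀ {y} → K y → ¬ Arc D v y) where

  open OutCover (out-cover (proj₁ ij) (proj₂ (proj₂ ij) v))

  acyclic : Acyclic D
  acyclic = proj₁ ij

  1≤i : 1 ≤ i
  1≤i = ≤-trans (s≤s z≤n) 4≤i

  indeg≤ : ∀ w → count (λ u → Arc? D u w) ≤ i
  indeg≤ w = ≤-trans (≤-reflexive (sym (indeg≡count D w))) (proj₁ (proj₂ ij) w)

  ¬3-out : ∀ {x a b c} → Arc D x a → Arc D x b → Arc D x c → a ≢ b → a ≢ c → b ≢ c → ⊥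
  ¬3-out = outdeg≤2⇒¬3-out D (proj₂ (proj₂ ij) _)

  hub : Fin 3 → Fin n
  hub 0F = v
  hub 1F = h₁
  hub 2F = h₂

  -- out-cover pads a missing out-neighbour of v with v itself; such a hub is not active.
  Active : Fin 3 → Set
  Active 0F = ⊤
  Active 1F = Arc D v h₁
  Active 2F = Arc D v h₂

  Active? : ∀ m → Dec (Active m)
  Active? 0F = yes tt
  Active? 1F = Arc? D v h₁
  Active? 2F = Arc? D v h₂

  IsHub : Pred (Fin n) 0ℓ
  IsHub w = w ≡ v ⊎ Arc D v w

  active-hub : ∀ m → Active m → IsHub (hub m)
  active-hub 0F _     = inj₁ refl
  active-hub 1F v⟶h₁ = inj₂ v⟶h₁
  active-hub 2F v⟶h₂ = inj₂ v⟶h₂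

  v⟶≢ : ∀ {w} → Arc D v w → v ≢ w
  v⟶≢ v⟶w refl = ¬loop acyclic v⟶w

  hubs-distinct : ∀ j k → j ≢ k → Active j → Active k → hub j ≢ hub k
  hubs-distinct 0F 0F j≢k _ _ = ⊥-elim (j≢k refl)
  hubs-distinct 1F 1F j≢k _ _ = ⊥-elim (j≢k refl)
  hubs-distinct 2F 2F j≢k _ _ = ⊥-elim (j≢k refl)
  hubs-distinct 0F 1F _ _ v⟶h₁ = v⟶≢ v⟶h₁
  hubs-distinct 0F 2F _ _ v⟶h₂ = v⟶≢ v⟶h₂
  hubs-distinct 1F 0F _ v⟶h₁ _ = v⟶≢ v⟶h₁ ∘ sym
  hubs-distinct 2F 0F _ v⟶h₂ _ = v⟶≢ v⟶h₂ ∘ sym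
  hubs-distinct 1F 2F _ v⟶h₁ v⟶h₂ = distinct v⟶h₁ v⟶h₂
  hubs-distinct 2F 1F _ v⟶h₂ v⟶h₁ = distinct v⟶h₁ v⟶h₂ ∘ sym

  U : Pred (Fin n) 0ℓ
  U x = K x × x ≢ v

  H : Fin 3 → Pred (Fin n) 0ℓ
  H m x = U x × Arc D x (hub m) × Active m

  Link : Rel (Fin n) 0ℓ
  Link x z = Arc D x z × ¬ IsHub z

  Link? : ∀ x z → Dec (Link x z)
  Link? x z = Arc? D x z ×-dec ¬? ((z ≟ v) ⊎-dec Arc? D v z)

  U-non-hub : ∀ {y} → U y → ¬ IsHub y
  U-non-hub (_ , y≢v) (inj₁ y≡v) = y≢v y≡v
  U-non-hub (Ky , _)  (inj₂ v⟶y) = v-sink Ky v⟶y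

  arc-into-hub : ∀ {x w} → U x → Arc D x w → IsHub w → ∃ λ m → H m x × hub m ≡ w
  arc-into-hub Ux x⟶w (inj₁ refl) = 0F , (Ux , x⟶w , tt) , refl
  arc-into-hub Ux x⟶w (inj₂ v⟶w) with covers v⟶w
  ... | inj₁ refl = 1F , (Ux , x⟶w , v⟶w) , refl
  ... | inj₂ refl = 2F , (Ux , x⟶w , v⟶w) , refl

  hub≢non-hub : ∀ m {z} → Active m → ¬ IsHub z → hub m ≢ z
  hub≢non-hub m act z∉hubs hub≡z = z∉hubs (subst IsHub hub≡z (active-hub m act))

  active⇒v⟶hub : ∀ {m} → m ≢ 0F → Active m → Arc D v (hub m)
  active⇒v⟶hub {0F} m≢0 _   = ⊥-elim (m≢0 refl)
  active⇒v⟶hub {1F} _   act = act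
  active⇒v⟶hub {2F} _   act = act

  U? : Decidable U
  U? x = K? x ×-dec ¬? (x ≟ v)

  H? : ∀ m → Decidable (H m)
  H? m x = U? x ×-dec Arc? D x (hub m) ×-dec Active? m

  covered : ∀ {x} → U x → ∃ λ m → H m x
  covered Ux@(Kx , x≢v) with clique Kx Kv x≢v
  ... | _ , inj₁ x⟶v                     = 0F , Ux , x⟶v , tt
  ... | _ , inj₂ (inj₁ v⟶x)              = ⊥-elim (v-sink Kx v⟶x)
  ... | _ , inj₂ (inj₂ (w , x⟶w , v⟶w)) with arc-into-hub Ux x⟶w (inj₂ v⟶w)
  ...   | m , Hmx , _ = m , Hmx

  ¬all-classes : ∀ {x} → U x → ¬ (∀ m → H m x)
  ¬all-classes _ in-all with in-all 0F | in-all 1F | in-all 2F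
  ... | _ , x⟶h₀ , a₀ | _ , x⟶h₁ , a₁ | _ , x⟶h₂ , a₂ =
    ¬3-out x⟶h₀ x⟶h₁ x⟶h₂
      (hubs-distinct 0F 1F (λ ()) a₀ a₁) (hubs-distinct 0F 2F (λ ()) a₀ a₂) (hubs-distinct 1F 2F (λ ()) a₁ a₂)

  class≤ : ∀ m → count (H? m) ≤ i
  class≤ m = ≤-trans (count-mono (proj₁ ∘ proj₂)) (indeg≤ (hub m))

  -- v itself is an in-neighbour of an active out-hub, but v ∉ U.
  out-class< : ∀ m → m ≢ 0F → count (H? m) < i
  out-class< m m≢0 = by-activity (Active? m)
    where
    by-activity : Dec (Active m) → count (H? m) < i
    by-activity (no ¬act) =
      ≤-trans (≤-reflexive (cong suc (count-empty (λ _ Hmx → ¬act (proj₂ (proj₂ Hmx)))))) 1≤i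
    by-activity (yes act) = begin
      suc (count (H? m))                 ≡⟨ cong (_+ count (H? m)) (count-singleton v) ⟨
      count (_≟ v) + count (H? m)        ≤⟨ count-disjoint (λ { refl → active⇒v⟶hub m≢0 act }) (proj₁ ∘ proj₂)
                                                           (λ { refl ((_ , v≢v) , _) → v≢v refl }) ⟩
      count (λ u → Arc? D u (hub m))     ≤⟨ indeg≤ (hub m) ⟩
      i                                  ∎
      where open ≤-Reasoning

  two-classes< : ∀ {j k} → j ≢ k → count (H? j) + count (H? k) < i + i
  two-classes< {j} {k} j≢k with j ≟ 0F
  ... | no j≢0    = +-mono-<-≤ (out-class< j j≢0) (class≤ k)
  ... | yes refl  = +-mono-≤-< (class≤ 0F) (out-class< k (j≢k ∘ sym))

  adjacent : ∀ {x y} → U x → U y → x ≢ y → (∀ m → H m x → H m y → ⊥) → CommonTarget Link x y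
  adjacent Ux Uy x≢y apart with clique (proj₁ Ux) (proj₁ Uy) x≢y
  ... | _ , inj₁ x⟶y          = _ , [ x⟶y , U-non-hub Uy ] , refl
  ... | _ , inj₂ (inj₁ y⟶x)   = _ , refl , [ y⟶x , U-non-hub Ux ]
  ... | _ , inj₂ (inj₂ (w , x⟶w , y⟶w)) with (w ≟ v) ⊎-dec Arc? D v w
  ...   | no w∉hubs = w , [ x⟶w , w∉hubs ] , [ y⟶w , w∉hubs ]
  ...   | yes w-hub with arc-into-hub Ux x⟶w w-hub
  ...     | m , Hmx@(_ , _ , act) , refl = ⊥-elim (apart m Hmx (Uy , y⟶w , act))

  two-classes⇒¬Link : ∀ {x j k z} → j ≢ k → H j x → H k x → ¬ Link x z
  two-classes⇒¬Link {j = j} {k} j≢k (_ , x⟶hj , aj) (_ , x⟶hk , ak) (x⟶z , z∉hubs) =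
    ¬3-out x⟶hj x⟶hk x⟶z (hubs-distinct j k j≢k aj ak) (hub≢non-hub j aj z∉hubs) (hub≢non-hub k ak z∉hubs)

  Link-functional : ∀ {x a b} → U x → Link x a → Link x b → a ≡ b
  Link-functional {a = a} {b} Ux (x⟶a , a∉hubs) (x⟶b , b∉hubs) with covered Ux
  ... | m , _ , x⟶h , act = decidable-stable (a ≟ b) λ a≢b →
    ¬3-out x⟶h x⟶a x⟶b (hub≢non-hub m act a∉hubs) (hub≢non-hub m act b∉hubs) a≢b

  hubClasses : HubClasses n i
  hubClasses = record
    { U = U ; U? = U? ; H = H ; H? = H? ; _⟶_ = Link ; _⟶?_ = Link?
    ; H⊆U = proj₁
    ; covered = covered
    ; ¬all-classes = ¬all-classes
    ; class≤ = class≤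
    ; two-classes< = two-classes<
    ; adjacent = adjacent
    ; two-classes⇒¬⟶ = two-classes⇒¬Link
    ; ⟶-functional = Link-functional
    ; in-links≤ = λ z → ≤-trans (count-mono proj₁) (indeg≤ z)
    ; ⟶-¬3-cycle = λ (a⟶b , _) (b⟶c , _) (c⟶a , _) → ¬3-cycle acyclic a⟶b b⟶c c⟶a
    }

  2*count≤3*i+2 : 2 * count K? ≤ 3 * i + 2
  2*count≤3*i+2 = begin
    2 * count K?              ≤⟨ *-monoʳ-≤ 2 (count-⊎ {Q? = _≟ v} {R? = U?} sink-or-U) ⟩
    2 * (count (_≟ v) + count U?) ≡⟨ cong (λ c → 2 * (c + count U?)) (count-singleton v) ⟩
    2 * (1 + count U?)        ≡⟨ *-distribˡ-+ 2 1 (count U?) ⟩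
    2 + 2 * count U?          ≤⟨ +-monoʳ-≤ 2 (HubClassesBound.2*count≤3*i hubClasses 4≤i) ⟩
    2 + 3 * i                 ≡⟨ +-comm 2 (3 * i) ⟩
    3 * i + 2                 ∎
    where
    open ≤-Reasoning
    sink-or-U : ∀ {x} → K x → x ≡ v ⊎ U x
    sink-or-U {x} Kx with x ≟ v
    ... | yes x≡v = inj₁ x≡v
    ... | no x≢v  = inj₂ (Kx , x≢v)

clique-bound : ∀ {n i} {D : Digraph n} → IsIJDigraph i 2 D → 4 ≤ i →
               (K : List (Fin n)) → IsClique (PAdj D) K → 2 * length K ≤ 3 * i + 2
clique-bound ij 4≤i []          _                  = z≤n
clique-bound ij 4≤i K@(_ ∷ _) (unique , adjacent) with sink (proj₁ ij) (λ x → Any.any? (x ≟_) K) (here refl)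
... | v , v∈K , v-sink = ≤-trans (*-monoʳ-≤ 2 (length≤count K unique (λ x∈K → x∈K)))
                                 (CliqueAtSink.2*count≤3*i+2 ij 4≤i (λ x → Any.any? (x ≟_) K) adjacent v∈K v-sink)

module _ (G : Graph) {D : Digraph (Graph.size G)} (f : Fin (Graph.size G) ⤖ Fin (Graph.size G))
         (adj⇔ : ∀ u v → Graph.Adj G u v ⇔ PAdj D (Bijection.to f u) (Bijection.to f v)) where

  open Bijection f using (to; injective)

  clique-image : ∀ {K} → IsClique (Graph.Adj G) K → IsClique (PAdj D) (map to K)
  clique-image {K} (unique , adjacent) = map⁺ injective unique , adjacent′
    where
    adjacent′ : ∀ {x y} → x ∈ map to K → y ∈ map to K → x ≢ y → PAdj D x y
    adjacent′ x∈ y∈ x≢y with ∈-map⁻ to x∈ | ∈-map⁻ to y∈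
    ... | x′ , x′∈K , refl | y′ , y′∈K , refl =
      Equivalence.to (adj⇔ x′ y′) (adjacent x′∈K y′∈K (x≢y ∘ cong to))

-- The extremal construction

length-filter-++ : ∀ {A : Set} {P : Pred A 0ℓ} (P? : Decidable P) (xs ys : List A) →
                   length (filter P? (xs ++ ys)) ≡ length (filter P? xs) + length (filter P? ys)
length-filter-++ P? xs ys = trans (cong length (filter-++ P? xs ys)) (length-++ (filter P? xs))

length-filter-replicate : ∀ {A : Set} {P : Pred A 0ℓ} (P? : Decidable P) k x →
                          length (filter P? (replicate k x)) ≡ (if does (P? x) then k else 0)
length-filter-replicate P? k x with P? x
... | yes Px = trans (cong length (filter-all P? (replicate⁺ k Px))) (length-replicate k)
... | no ¬Px = cong length (filter-none P? (replicate⁺ k ¬Px))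

data Kind : Set where
  A B C AB AC BC : Kind

_⇒_ : Kind → Kind → Bool
A  ⇒ B = true
B  ⇒ C = true
AB ⇒ A = true
AB ⇒ B = true
AC ⇒ A = true
AC ⇒ C = true
BC ⇒ B = true
BC ⇒ C = true
_  ⇒ _ = false

_⇒?_ : ∀ k l → Dec (T (k ⇒ l))
k ⇒? l = T? (k ⇒ l)

rank : Kind → ℕ
rank C = 0
rank B = 1
rank A = 2
rank _ = 3

⇒-descends : ∀ {k l} → T (k ⇒ l) → rank l < rank k
⇒-descends {A}  {B} _ = s≤s (s≤s z≤n)
⇒-descends {B}  {C} _ = s≤s z≤n
⇒-descends {AB} {A} _ = s≤s (s≤s (s≤s z≤n))
⇒-descends {AB} {B} _ = s≤s (s≤s z≤n)
⇒-descends {AC} {A} _ = s≤s (s≤s (s≤s z≤n))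
⇒-descends {AC} {C} _ = s≤s z≤n
⇒-descends {BC} {B} _ = s≤s (s≤s z≤n)
⇒-descends {BC} {C} _ = s≤s z≤n

base : Fin 3 → Kind
base 0F = C
base 1F = B
base 2F = A

KindAdjacent : Kind → Kind → Set
KindAdjacent k l = T (k ⇒ l) ⊎ T (l ⇒ k) ⊎ ∃ λ b → T (k ⇒ base b) × T (l ⇒ base b)

kinds-adjacent : ∀ k l → k ≢ C → l ≢ C → KindAdjacent k l
kinds-adjacent C  _  k≢C _   = ⊥-elim (k≢C refl)
kinds-adjacent _  C  _   l≢C = ⊥-elim (l≢C refl)
kinds-adjacent A  A  _ _ = inj₂ (inj₂ (1F , tt , tt))
kinds-adjacent A  B  _ _ = inj₁ tt
kinds-adjacent A  AB _ _ = inj₂ (inj₁ tt)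
kinds-adjacent A  AC _ _ = inj₂ (inj₁ tt)
kinds-adjacent A  BC _ _ = inj₂ (inj₂ (1F , tt , tt))
kinds-adjacent B  A  _ _ = inj₂ (inj₁ tt)
kinds-adjacent B  B  _ _ = inj₂ (inj₂ (0F , tt , tt))
kinds-adjacent B  AB _ _ = inj₂ (inj₁ tt)
kinds-adjacent B  AC _ _ = inj₂ (inj₂ (0F , tt , tt))
kinds-adjacent B  BC _ _ = inj₂ (inj₁ tt)
kinds-adjacent AB A  _ _ = inj₁ tt
kinds-adjacent AB B  _ _ = inj₁ tt
kinds-adjacent AB AB _ _ = inj₂ (inj₂ (2F , tt , tt))
kinds-adjacent AB AC _ _ = inj₂ (inj₂ (2F , tt , tt))
kinds-adjacent AB BC _ _ = inj₂ (inj₂ (1F , tt , tt))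
kinds-adjacent AC A  _ _ = inj₁ tt
kinds-adjacent AC B  _ _ = inj₂ (inj₂ (0F , tt , tt))
kinds-adjacent AC AB _ _ = inj₂ (inj₂ (2F , tt , tt))
kinds-adjacent AC AC _ _ = inj₂ (inj₂ (2F , tt , tt))
kinds-adjacent AC BC _ _ = inj₂ (inj₂ (0F , tt , tt))
kinds-adjacent BC A  _ _ = inj₂ (inj₂ (1F , tt , tt))
kinds-adjacent BC B  _ _ = inj₁ tt
kinds-adjacent BC AB _ _ = inj₂ (inj₂ (1F , tt , tt))
kinds-adjacent BC AC _ _ = inj₂ (inj₂ (0F , tt , tt))
kinds-adjacent BC BC _ _ = inj₂ (inj₂ (1F , tt , tt))

module Construction (m q : ℕ) where

  groups : List Kind
  groups = replicate m AB ++ replicate m AC ++ replicate q BC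

  layout : List Kind
  layout = C ∷ B ∷ A ∷ groups

  n : ℕ
  n = length layout

  kind : Fin n → Kind
  kind = List.lookup layout

  D : Digraph n
  D x y = kind x ⇒ kind y

  length-filter-layout : ∀ {P : Pred Kind 0ℓ} (P? : Decidable P) →
    length (filter P? layout) ≡
      length (filter P? (C ∷ B ∷ A ∷ [])) +
        ((if does (P? AB) then m else 0) + ((if does (P? AC) then m else 0) + (if does (P? BC) then q else 0)))
  length-filter-layout P? =
    trans (length-filter-++ P? (C ∷ B ∷ A ∷ []) groups)
      (cong (length (filter P? (C ∷ B ∷ A ∷ [])) +_)
        (trans (length-filter-++ P? (replicate m AB) _)
          (cong₂ _+_ (length-filter-replicate P? m AB)
            (trans (length-filter-++ P? (replicate m AC) _)
              (cong₂ _+_ (length-filter-replicate P? m AC) (length-filter-replicate P? q BC))))))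

  indeg≡ : ∀ w → indeg D w ≡ length (filter (_⇒? kind w) layout)
  indeg≡ w = trans (length-filter-allFin (λ u → T? (D u w))) (count-lookup (_⇒? kind w) layout)

  outdeg≡ : ∀ u → outdeg D u ≡ length (filter (kind u ⇒?_) layout)
  outdeg≡ u = trans (length-filter-allFin (λ w → T? (D u w))) (count-lookup (kind u ⇒?_) layout)

  kind-outdeg≤2 : ∀ k → length (filter (k ⇒?_) layout) ≤ 2
  kind-outdeg≤2 A  = ≤-trans (≤-reflexive (length-filter-layout (A  ⇒?_))) (s≤s z≤n)
  kind-outdeg≤2 B  = ≤-trans (≤-reflexive (length-filter-layout (B  ⇒?_))) (s≤s z≤n)
  kind-outdeg≤2 C  = ≤-trans (≤-reflexive (length-filter-layout (C  ⇒?_))) z≤n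
  kind-outdeg≤2 AB = ≤-reflexive (length-filter-layout (AB ⇒?_))
  kind-outdeg≤2 AC = ≤-reflexive (length-filter-layout (AC ⇒?_))
  kind-outdeg≤2 BC = ≤-reflexive (length-filter-layout (BC ⇒?_))

  module _ {i : ℕ} (1+m+q≤i : suc (m + q) ≤ i) (m+m≤i : m + m ≤ i) where

    kind-indeg≤ : ∀ k → length (filter (_⇒? k) layout) ≤ i
    kind-indeg≤ A  = ≤-trans (≤-reflexive (length-filter-layout (_⇒? A)))
                             (≤-trans (≤-reflexive (cong (m +_) (+-identityʳ m))) m+m≤i)
    kind-indeg≤ B  = ≤-trans (≤-reflexive (length-filter-layout (_⇒? B))) 1+m+q≤i
    kind-indeg≤ C  = ≤-trans (≤-reflexive (length-filter-layout (_⇒? C))) 1+m+q≤i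
    kind-indeg≤ AB = ≤-trans (≤-reflexive (length-filter-layout (_⇒? AB))) z≤n
    kind-indeg≤ AC = ≤-trans (≤-reflexive (length-filter-layout (_⇒? AC))) z≤n
    kind-indeg≤ BC = ≤-trans (≤-reflexive (length-filter-layout (_⇒? BC))) z≤n

    isIJ : IsIJDigraph i 2 D
    isIJ = ranked⇒acyclic (rank ∘ kind) ⇒-descends
         , (λ w → ≤-trans (≤-reflexive (indeg≡ w)) (kind-indeg≤ (kind w)))
         , (λ u → ≤-trans (≤-reflexive (outdeg≡ u)) (kind-outdeg≤2 (kind u)))

  kind-suc≢C : ∀ x → kind (suc x) ≢ C
  kind-suc≢C 0F            = λ ()
  kind-suc≢C 1F            = λ ()
  kind-suc≢C (suc (suc g)) = All.lookup groups≢C (∈-lookup g)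
    where
    groups≢C : All (_≢ C) groups
    groups≢C = ++⁺ (replicate⁺ m λ ()) (++⁺ (replicate⁺ m λ ()) (replicate⁺ q λ ()))

  K : List (Fin n)
  K = tabulate suc

  clique : IsClique (PAdj D) K
  clique = tabulate⁺ suc-injective , adjacent
    where
    via-kinds : ∀ {x y} → KindAdjacent (kind x) (kind y) →
                Arc D x y ⊎ Arc D y x ⊎ ∃ λ w → Arc D x w × Arc D y w
    via-kinds (inj₁ x⟶y)                    = inj₁ x⟶y
    via-kinds (inj₂ (inj₁ y⟶x))             = inj₂ (inj₁ y⟶x)
    via-kinds (inj₂ (inj₂ (0F , x⟶C , y⟶C))) = inj₂ (inj₂ (0F , x⟶C , y⟶C))
    via-kinds (inj₂ (inj₂ (1F , x⟶B , y⟶B))) = inj₂ (inj₂ (1F , x⟶B , y⟶B))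
    via-kinds (inj₂ (inj₂ (2F , x⟶A , y⟶A))) = inj₂ (inj₂ (2F , x⟶A , y⟶A))
    adjacent : ∀ {x y} → x ∈ K → y ∈ K → x ≢ y → PAdj D x y
    adjacent x∈K y∈K x≢y with ∈-tabulate⁻ {f = suc} x∈K | ∈-tabulate⁻ {f = suc} y∈K
    ... | x′ , refl | y′ , refl =
      x≢y , via-kinds {suc x′} {suc y′} (kinds-adjacent _ _ (kind-suc≢C x′) (kind-suc≢C y′))

  length-K : length K ≡ 2 + (m + (m + q))
  length-K = begin
    length K                                                          ≡⟨ length-tabulate suc ⟩
    2 + length (replicate m AB ++ replicate m AC ++ replicate q BC)   ≡⟨ cong (2 +_) (length-++ (replicate m AB)) ⟩
    2 + (length (replicate m AB) + length (replicate m AC ++ replicate q BC))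
      ≡⟨ cong (λ l → 2 + (length (replicate m AB) + l)) (length-++ (replicate m AC)) ⟩
    2 + (length (replicate m AB) + (length (replicate m AC) + length (replicate q BC)))
      ≡⟨ cong₂ (λ a b → 2 + (a + b)) (length-replicate m) (cong₂ _+_ (length-replicate m) (length-replicate q)) ⟩
    2 + (m + (m + q))                                                 ∎
    where open ≡-Reasoning

clique-of-size : ∀ {i} m q → suc (m + q) ≤ i → m + m ≤ i →
                 Σ ℕ λ n → Σ (Digraph n) λ D → IsIJDigraph i 2 D ×
                   Σ (List (Fin n)) λ K → IsClique (PAdj D) K × length K ≡ 2 + (m + (m + q))
clique-of-size m q 1+m+q≤i m+m≤i = n , D , isIJ 1+m+q≤i m+m≤i , K , clique , length-K
  where open Construction m q

even-or-odd : ∀ i → ∃ λ t → i ≡ t + t ⊎ i ≡ suc (t + t)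
even-or-odd zero          = 0 , inj₁ refl
even-or-odd (suc zero)    = 0 , inj₂ refl
even-or-odd (suc (suc i)) with even-or-odd i
... | t , inj₁ refl = suc t , inj₁ (cong suc (sym (+-suc t t)))
... | t , inj₂ refl = suc t , inj₂ (cong (λ x → suc (suc x)) (sym (+-suc t t)))

half : ∀ {x} r k → r < 2 → x ≡ r + k * 2 → x / 2 ≡ k
half r k r<2 refl = begin
  (r + k * 2) / 2      ≡⟨ +-distrib-/-∣ʳ r (divides k refl) ⟩
  r / 2 + k * 2 / 2    ≡⟨ cong₂ _+_ (m<n⇒m/n≡0 r<2) (m*n/n≡m k 2) ⟩
  k                    ∎
  where open ≡-Reasoning

large-clique : ∀ i → 4 ≤ i → Σ ℕ λ n → Σ (Digraph n) λ D → IsIJDigraph i 2 D ×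
                 Σ (List (Fin n)) λ K → IsClique (PAdj D) K × length K ≡ (3 * i) / 2 + 1
large-clique i 4≤i with even-or-odd i
... | zero  , inj₁ refl = ⊥-elim (<⇒≱ 4≤i z≤n)
... | suc s , inj₁ refl with clique-of-size (suc s) s (≤-reflexive (sym (+-suc (suc s) s))) ≤-refl
...   | n , D , ij , K , K-clique , length-K = n , D , ij , K , K-clique , trans length-K size
  where
  size : 2 + (suc s + (suc s + s)) ≡ 3 * (suc s + suc s) / 2 + 1
  size = trans (e₁ s) (cong (_+ 1) (sym (half 0 (3 * suc s) (s≤s z≤n) (e₂ s))))
    where
    e₁ : ∀ s → 2 + (suc s + (suc s + s)) ≡ 3 * suc s + 1
    e₁ = solve-∀
    e₂ : ∀ s → 3 * (suc s + suc s) ≡ 0 + 3 * suc s * 2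
    e₂ = solve-∀
large-clique i 4≤i | t , inj₂ refl with clique-of-size t t ≤-refl (n≤1+n (t + t))
...   | n , D , ij , K , K-clique , length-K = n , D , ij , K , K-clique , trans length-K size
  where
  size : 2 + (t + (t + t)) ≡ 3 * suc (t + t) / 2 + 1
  size = trans (e₁ t) (cong (_+ 1) (sym (half 1 (3 * t + 1) ≤-refl (e₂ t))))
    where
    e₁ : ∀ t → 2 + (t + (t + t)) ≡ 3 * t + 1 + 1
    e₁ = solve-∀
    e₂ : ∀ t → 3 * suc (t + t) ≡ 1 + (3 * t + 1) * 2
    e₂ = solve-∀

theorem3p12 : (∀ (i : ℕ) → 4 ≤ i → (G : Graph) → IsPhylogenyGraph i 2 G →
                (K : List (Fin (Graph.size G))) → IsClique (Graph.Adj G) K → 2 * length K ≤ 3 * i + 2)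
            × (∀ (i : ℕ) → 4 ≤ i → Σ ℕ λ n → Σ (Digraph n) λ D → IsIJDigraph i 2 D ×
                Σ (List (Fin n)) λ K → IsClique (PAdj D) K × length K ≡ (3 * i) / 2 + 1)
theorem3p12 =
  (λ i 4≤i G (D , ij , f , adj⇔) K K-clique →
     subst (λ l → 2 * l ≤ 3 * i + 2) (length-map (Bijection.to f) K)
           (clique-bound ij 4≤i _ (clique-image G f adj⇔ K-clique)))
  , large-clique
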